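{- Let $\mathbf{c}=(\mathbf{p},I)$ be a coloring problem on a finite set $M$ and $\mathbf{d}=(\mathbf{q},J)$ a coloring problem on a finite set $N$ with $M\cap N=\emptyset$. Then $\hat{\chi}(\mathbf{c}\cdot\mathbf{d})=\hat{\chi}(\mathbf{c})\,\hat{\chi}(\mathbf{d})$, and moreover $\chi(\mathbf{c}\cdot\mathbf{d},x)=\chi(\mathbf{c},x)\,\chi(\mathbf{d},x)$.
   Context: A coloring problem on a finite set $N$ is a pair $(\mathbf{p},I)$ where $\mathbf{p}$ is a family of subsets of $N$ with $\emptyset,N\in\mathbf{p}$, partially ordered by inclusion; writing $\mathrm{Int}(\mathbf{p})$ for the set of intervals $[S,T]$ ($S\subseteq T$, $S,T\in\mathbf{p}$) ordered by inclusion, $I$ is an order ideal of $\mathrm{Int}(\mathbf{p})$ (if $[S,T]\in I$ and $S\subseteq S'\subseteq T'\subseteq T$ with $S',T'\in\mathbf{p}$ then $[S',T']\in I$) containing $[S,S]$ for every $S\in\mathbf{p}$. A proper coloring of $(\mathbf{p},I)$ is a function $f:N\to\mathbb{Z}_{>0}$ such that for every integer $n\ge 0$ we have $[f^{ -1}([n]),f^{ -1}([n+1])]\in I$ (in particular both sets lie in $\mathbf{p}$), where $[n]=\{1,\dots,n\}$ and $[0]=\emptyset$. With commuting indeterminates $x_1,x_2,\dots$, the chromatic quasisymmetric function is $\hat{\chi}(\mathbf{p},I)=\sum_f\prod_{v\in N}x_{f(v)}$, summed over proper colorings $f$; the chromatic polynomial $\chi(\mathbf{p},I,n)$ is the number of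 proper colorings with values in $\{1,\dots,n\}$ (a polynomial in $n$). The product of coloring problems $(\mathbf{p},I)$ on $M$ and $(\mathbf{q},J)$ on disjoint $N$ is the coloring problem $(\mathbf{p}\cdot\mathbf{q},I\cdot J)$ on $M\cup N$ with $\mathbf{p}\cdot\mathbf{q}=\{X\cup Y: X\in\mathbf{p},Y\in\mathbf{q}\}$ and $I\cdot J=\{[X\cup Y,X'\cup Y']:[X,X']\in I,[Y,Y']\in J\}$. -}

module Defs where

open import Data.Nat using (ℕ; zero; suc; _+_; _*_; _∸_; _≤_; _<_; _≤ᵇ_; _⊔_; _≤?_; s≤s; z≤n)
open import Data.Nat.Properties using (≤⇒≤ᵇ; m⊔n≤o⇒m≤o; m⊔n≤o⇒n≤o; ≰⇒>; <⇒≤; ≤-refl; m≤n⇒m≤1+n)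
import Data.Nat.Properties as ℕP
open import Data.Bool using (Bool; true; false; _∧_)
open import Data.Bool.Properties using (T-≡)
import Data.Bool.Properties as BP
open import Data.Fin using (Fin; toℕ; fromℕ<)
open import Data.Fin.Properties using (toℕ-fromℕ<)
import Data.Fin.Properties as FP
open import Data.Fin.Subset using (Subset; _⊆_; ⊥; ⊤)
open import Data.Vec using (Vec; []; _∷_; take; drop; replicate)
import Data.Vec as V
open import Data.Vec.Relation.Unary.All using (All; all?)
open import Data.List using (List; []; _∷_; length; filter; applyUpTo; upTo; concatMap)
open import Data.Nat.ListAction using (sum)
import Data.List as L
open import Data.List.Properties using (≡-dec)
open import Data.Product using (_×_; _,_; proj₁; proj₂)
open import Relation.Nullary using (Dec; yes; no; ¬_)
open import Relation.Binary.PropositionalEquality using (_≡_; refl; sym; trans; cong; subst)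
open import Function.Bundles using (Equivalence)

-- The family p is given by its (Boolean) characteristic function `fam`,
-- and the set I of intervals by `ideal S T` (true iff [S,T] ∈ I).

record RawCP (m : ℕ) : Set where
  field
    fam   : Subset m → Bool
    ideal : Subset m → Subset m → Bool
open RawCP public

record IsColoringProblem {m : ℕ} (c : RawCP m) : Set where
  field
    empty∈p  : fam c ⊥ ≡ true
    full∈p   : fam c ⊤ ≡ true
    interval : ∀ S T → ideal c S T ≡ true → fam c S ≡ true × fam c T ≡ true × S ⊆ T
    downward : ∀ S T S' T' → ideal c S T ≡ true → fam c S' ≡ true → fam c T' ≡ true →
               S ⊆ S' → S' ⊆ T' → T' ⊆ T → ideal c S' T' ≡ true
    refl∈I   : ∀ S → fam c S ≡ true → ideal c S S ≡ true

-- Product of coloring problems on Fin m and Fin n: the ground set is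
-- Fin (m + n), the disjoint union; a subset Z of it is uniquely X ∪ Y with
-- X = take m Z ⊆ M and Y = drop m Z ⊆ N.
_⊗_ : ∀ {m n} → RawCP m → RawCP n → RawCP (m + n)
_⊗_ {m} c d = record
  { fam   = λ Z → fam c (take m Z) ∧ fam d (drop m Z)
  ; ideal = λ Z Z' → ideal c (take m Z) (take m Z') ∧ ideal d (drop m Z) (drop m Z')
  }

-- Colorings f : Fin m → ℤ>0 are represented as vectors of naturals.

pre : ∀ {m} → ℕ → Vec ℕ m → Subset m
pre k v = V.map (λ x → x ≤ᵇ k) v

Proper : ∀ {m} → RawCP m → Vec ℕ m → Set
Proper c v = All (1 ≤_) v × (∀ k → ideal c (pre k v) (pre (suc k) v) ≡ true)

maxV : ∀ {m} → Vec ℕ m → ℕ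
maxV []       = 0
maxV (x ∷ xs) = x ⊔ maxV xs

pre-full : ∀ {m} (v : Vec ℕ m) k → maxV v ≤ k → pre k v ≡ replicate m true
pre-full []       k h = refl
pre-full (x ∷ xs) k h =
  cong₂′ (Equivalence.to T-≡ (≤⇒≤ᵇ (m⊔n≤o⇒m≤o x (maxV xs) h)))
         (pre-full xs k (m⊔n≤o⇒n≤o x (maxV xs) h))
  where
  cong₂′ : ∀ {n} {a : Bool} {as bs : Vec Bool n} → a ≡ true → as ≡ bs → (a ∷ as) ≡ (true ∷ bs)
  cong₂′ refl refl = refl

proper? : ∀ {m} (c : RawCP m) (v : Vec ℕ m) → Dec (Proper c v)
proper? c v with all? (λ x → 1 ≤? x) v
... | no ¬p = no (λ h → ¬p (proj₁ h))
... | yes p with FP.all? {n = suc (maxV v)}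
                   (λ i → ideal c (pre (toℕ i) v) (pre (suc (toℕ i)) v) BP.≟ true)
...   | no ¬q = no (λ h → ¬q (λ i → proj₂ h (toℕ i)))
...   | yes q = yes (p , helper)
  where
  B = maxV v
  atB : ideal c (pre B v) (pre (suc B) v) ≡ true
  atB = subst (λ k → ideal c (pre k v) (pre (suc k) v) ≡ true)
              (toℕ-fromℕ< (ℕP.n<1+n B)) (q (fromℕ< (ℕP.n<1+n B)))
  helper : ∀ k → ideal c (pre k v) (pre (suc k) v) ≡ true
  helper k with k ≤? B
  ... | yes k≤B = subst (λ j → ideal c (pre j v) (pre (suc j) v) ≡ true)
                        (toℕ-fromℕ< (s≤s k≤B)) (q (fromℕ< (s≤s k≤B)))
  ... | no k≰B =
    let B≤k = <⇒≤ (≰⇒> k≰B)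
        e1 = trans (pre-full v k B≤k) (sym (pre-full v B ≤-refl))
        e2 = trans (pre-full v (suc k) (m≤n⇒m≤1+n B≤k))
                   (sym (pre-full v (suc B) (m≤n⇒m≤1+n ≤-refl)))
    in subst (λ Z → ideal c Z (pre (suc k) v) ≡ true) (sym e1)
         (subst (λ Z → ideal c (pre B v) Z ≡ true) (sym e2) atB)

colorings : (K m : ℕ) → List (Vec ℕ m)
colorings K zero    = [] ∷ []
colorings K (suc m) = concatMap (λ x → L.map (x ∷_) (colorings K m)) (applyUpTo suc K)

chromPoly : ∀ {m} → RawCP m → ℕ → ℕ
chromPoly {m} c x = length (filter (proper? c) (colorings x m))

-- A monomial x₁^α₁ ⋯ x_K^α_K is
-- represented by the list α = (α₁, …, α_K) (trailing zeros allowed; the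
-- coefficient functions below do not depend on them).
Monomial : Set
Monomial = List ℕ

PowerSeries : Set
PowerSeries = Monomial → ℕ

-- all ways to write α = β + γ componentwise
splits : Monomial → List (Monomial × Monomial)
splits []      = ([] , []) ∷ []
splits (a ∷ α) = concatMap (λ i → L.map (λ bg → (i ∷ proj₁ bg , (a ∸ i) ∷ proj₂ bg)) (splits α))
                           (upTo (suc a))

_⋆_ : PowerSeries → PowerSeries → PowerSeries
(F ⋆ G) α = sum (L.map (λ bg → F (proj₁ bg) * G (proj₂ bg)) (splits α))

content : ∀ {m} → ℕ → Vec ℕ m → Monomial
content K v = L.map (λ i → V.count (λ x → x Data.Nat.≟ i) v) (applyUpTo suc K)
  where import Data.Nat

-- Chromatic quasisymmetric function: the coefficient of x^α is the number of
-- proper colorings f with |f⁻¹(i)| = α_i for all i (such f take values in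
-- [length α]).
chromQSym : ∀ {m} → RawCP m → PowerSeries
chromQSym {m} c α =
  length (filter (λ v → ≡-dec Data.Nat._≟_ (content (length α) v) α)
                 (filter (proper? c) (colorings (length α) m)))
  where import Data.Nat

-- A coloring of the product is the concatenation u ++ w of colorings of the factors,
-- and it is proper iff u and w are: the preimages f⁻¹([k]) and the product ideal both
-- split along M ⊎ N. Counting therefore factors as a double sum over pairs (u , w),
-- which gives χ(c·d) = χ(c) χ(d). For χ̂ one also weighs by content; the content of
-- u ++ w is the componentwise sum of the contents, and summing the indicator of
-- content = α over all pairs is the convolution over the splittings α = β + γ.
module Submission where

open import Defs
open import Algebra.Properties.CommutativeSemigroup using (interchange)
open import Data.Bool using (Bool; true; false; _∧_; if_then_else_)
open import Data.Empty using (⊥-elim)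
open import Data.Fin.Subset using (Subset)
open import Data.List using (List; []; _∷_; length; filter; map; applyUpTo; upTo; concatMap; zipWith)
open import Data.List.Properties using (≡-dec; map-∘; map-cong; map-++; map-applyUpTo; ∷-injective; length-map; length-applyUpTo)
open import Data.List.Relation.Unary.All using (All; universal)
import Data.List.Relation.Unary.All as All
open import Data.List.Relation.Unary.All.Properties using (concat⁺; map⁺)
open import Data.Nat using (ℕ; zero; suc; _+_; _*_; _∸_; _≟_; _≤ᵇ_)
open import Data.Nat.ListAction using (sum)
open import Data.Nat.ListAction.Properties using (sum-++)
open import Data.Nat.Properties using (+-identityʳ; *-identityˡ; *-zeroʳ; *-comm; *-distribˡ-+; suc-injective; +-commutativeSemigroup; *-commutativeSemigroup)
open import Data.Product using (_×_; _,_; proj₁; proj₂)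
import Data.Product as Product
open import Data.Vec using (Vec; []; _∷_; take; drop; _++_)
import Data.Vec as Vec
import Data.Vec.Properties as Vec
import Data.Vec.Relation.Unary.All.Properties as VecAll
open import Function using (_∘_; id)
open import Function.Bundles using (_⇔_; mk⇔; Equivalence)
open import Relation.Nullary using (Dec; yes; no; does; _×-dec_)
open import Relation.Binary.PropositionalEquality using (_≡_; refl; sym; trans; cong; cong₂)
open Relation.Binary.PropositionalEquality.≡-Reasoning

private
  variable
    A B : Set
    m n : ℕ

∑ : (A → ℕ) → List A → ℕ
∑ f xs = sum (map f xs)

infix 5 ∑
syntax ∑ (λ x → e) xs = ∑[ x ∈ xs ] e

∑-cong : {f g : A → ℕ} → (∀ x → f x ≡ g x) → ∀ xs → ∑ f xs ≡ ∑ g xs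
∑-cong f≗g xs = cong sum (map-cong f≗g xs)

∑-cong-All : {f g : A → ℕ} {xs : List A} → All (λ x → f x ≡ g x) xs → ∑ f xs ≡ ∑ g xs
∑-cong-All All.[]         = refl
∑-cong-All (eq All.∷ eqs) = cong₂ _+_ eq (∑-cong-All eqs)

∑-zero : (xs : List A) → ∑[ _ ∈ xs ] 0 ≡ 0
∑-zero []       = refl
∑-zero (_ ∷ xs) = ∑-zero xs

∑-++ : (f : A → ℕ) (xs ys : List A) → ∑ f (xs Data.List.++ ys) ≡ ∑ f xs + ∑ f ys
∑-++ f xs ys = trans (cong sum (map-++ f xs ys)) (sum-++ (map f xs) (map f ys))

∑-map : (f : B → ℕ) (g : A → B) (xs : List A) → ∑ f (map g xs) ≡ ∑ (f ∘ g) xs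
∑-map f g xs = cong sum (sym (map-∘ xs))

∑-concatMap : (f : B → ℕ) (g : A → List B) (xs : List A) →
              ∑ f (concatMap g xs) ≡ ∑[ x ∈ xs ] ∑ f (g x)
∑-concatMap f g []       = refl
∑-concatMap f g (x ∷ xs) =
  trans (∑-++ f (g x) (concatMap g xs)) (cong (∑ f (g x) +_) (∑-concatMap f g xs))

∑-+ : (f g : A → ℕ) (xs : List A) → ∑[ x ∈ xs ] (f x + g x) ≡ ∑ f xs + ∑ g xs
∑-+ f g []       = refl
∑-+ f g (x ∷ xs) =
  trans (cong (f x + g x +_) (∑-+ f g xs))
        (interchange +-commutativeSemigroup (f x) (g x) (∑ f xs) (∑ g xs))

∑-*ˡ : (k : ℕ) (f : A → ℕ) (xs : List A) → ∑[ x ∈ xs ] k * f x ≡ k * ∑ f xs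
∑-*ˡ k f []       = sym (*-zeroʳ k)
∑-*ˡ k f (x ∷ xs) =
  trans (cong (k * f x +_) (∑-*ˡ k f xs)) (sym (*-distribˡ-+ k (f x) (∑ f xs)))

∑-*ʳ : (k : ℕ) (f : A → ℕ) (xs : List A) → ∑[ x ∈ xs ] f x * k ≡ ∑ f xs * k
∑-*ʳ k f xs =
  trans (∑-cong (λ x → *-comm (f x) k) xs) (trans (∑-*ˡ k f xs) (*-comm k (∑ f xs)))

∑-comm : (f : A → B → ℕ) (xs : List A) (ys : List B) →
         ∑[ x ∈ xs ] ∑[ y ∈ ys ] f x y ≡ ∑[ y ∈ ys ] ∑[ x ∈ xs ] f x y
∑-comm f []       ys = sym (∑-zero ys)
∑-comm f (x ∷ xs) ys =
  trans (cong (∑ (f x) ys +_) (∑-comm f xs ys)) (sym (∑-+ (f x) _ ys))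

∑*∑ : (f : A → ℕ) (g : B → ℕ) (xs : List A) (ys : List B) →
      ∑ f xs * ∑ g ys ≡ ∑[ x ∈ xs ] ∑[ y ∈ ys ] f x * g y
∑*∑ f g xs ys =
  trans (sym (∑-*ʳ (∑ g ys) f xs)) (∑-cong (λ x → sym (∑-*ˡ (f x) g ys)) xs)

∑-upTo-suc : (f : ℕ → ℕ) (a : ℕ) → ∑ f (upTo (suc a)) ≡ f 0 + ∑ (f ∘ suc) (upTo a)
∑-upTo-suc f a =
  cong (f 0 +_) (trans (cong (∑ f) (sym (map-applyUpTo id suc a))) (∑-map f suc (upTo a)))

𝟙 : {P : Set} → Dec P → ℕ
𝟙 P? = if does P? then 1 else 0

𝟙-⇔ : {P Q : Set} (P? : Dec P) (Q? : Dec Q) → P ⇔ Q → 𝟙 P? ≡ 𝟙 Q?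
𝟙-⇔ (yes _) (yes _) _   = refl
𝟙-⇔ (no _)  (no _)  _   = refl
𝟙-⇔ (yes p) (no ¬q) P⇔Q = ⊥-elim (¬q (Equivalence.to P⇔Q p))
𝟙-⇔ (no ¬p) (yes q) P⇔Q = ⊥-elim (¬p (Equivalence.from P⇔Q q))

𝟙-× : {P Q : Set} (P? : Dec P) (Q? : Dec Q) → 𝟙 (P? ×-dec Q?) ≡ 𝟙 P? * 𝟙 Q?
𝟙-× (yes _) (yes _) = refl
𝟙-× (yes _) (no _)  = refl
𝟙-× (no _)  _       = refl

length-filter : {P : A → Set} (P? : ∀ x → Dec (P x)) (xs : List A) →
                length (filter P? xs) ≡ ∑[ x ∈ xs ] 𝟙 (P? x)
length-filter P? []       = refl
length-filter P? (x ∷ xs) with does (P? x)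
... | true  = cong suc (length-filter P? xs)
... | false = length-filter P? xs

∑-filter : {P : A → Set} (P? : ∀ x → Dec (P x)) (f : A → ℕ) (xs : List A) →
           ∑ f (filter P? xs) ≡ ∑[ x ∈ xs ] 𝟙 (P? x) * f x
∑-filter P? f []       = refl
∑-filter P? f (x ∷ xs) with does (P? x)
... | true  = cong₂ _+_ (sym (+-identityʳ (f x))) (∑-filter P? f xs)
... | false = ∑-filter P? f xs

δ : ℕ → ℕ → ℕ
δ a b = 𝟙 (a ≟ b)

δᴹ : Monomial → Monomial → ℕ
δᴹ α β = 𝟙 (≡-dec _≟_ α β)

δ-suc : ∀ a b → δ (suc a) (suc b) ≡ δ a b
δ-suc a b = 𝟙-⇔ (suc a ≟ suc b) (a ≟ b) (mk⇔ suc-injective (cong suc))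

δᴹ-∷ : ∀ a α b β → δᴹ (a ∷ α) (b ∷ β) ≡ δ a b * δᴹ α β
δᴹ-∷ a α b β =
  trans (𝟙-⇔ (≡-dec _≟_ (a ∷ α) (b ∷ β)) ((a ≟ b) ×-dec (≡-dec _≟_ α β))
             (mk⇔ ∷-injective λ { (refl , refl) → refl }))
        (𝟙-× (a ≟ b) (≡-dec _≟_ α β))

δ-convolution : ∀ a b g → ∑[ i ∈ upTo (suc a) ] δ b i * δ g (a ∸ i) ≡ δ (b + g) a
δ-convolution a zero g =
  trans (∑-upTo-suc (λ i → δ zero i * δ g (a ∸ i)) a)
        (trans (cong₂ _+_ (*-identityˡ (δ g a)) (∑-zero (upTo a))) (+-identityʳ (δ g a)))
δ-convolution zero    (suc b) g = refl
δ-convolution (suc a) (suc b) g = begin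
  ∑[ i ∈ upTo (suc (suc a)) ] δ (suc b) i * δ g (suc a ∸ i)
    ≡⟨ ∑-upTo-suc (λ i → δ (suc b) i * δ g (suc a ∸ i)) (suc a) ⟩
  ∑[ i ∈ upTo (suc a) ] δ (suc b) (suc i) * δ g (a ∸ i)
    ≡⟨ ∑-cong (λ i → cong (_* δ g (a ∸ i)) (δ-suc b i)) (upTo (suc a)) ⟩
  ∑[ i ∈ upTo (suc a) ] δ b i * δ g (a ∸ i)
    ≡⟨ δ-convolution a b g ⟩
  δ (b + g) a
    ≡⟨ sym (δ-suc (b + g) a) ⟩
  δ (suc b + g) (suc a) ∎

splits-length : ∀ α → All (λ s → length (proj₁ s) ≡ length α × length (proj₂ s) ≡ length α) (splits α)
splits-length []      = (refl , refl) All.∷ All.[]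
splits-length (a ∷ α) =
  concat⁺ (map⁺ (universal (λ i → map⁺ (All.map (Product.map (cong suc) (cong suc)) (splits-length α)))
                           (upTo (suc a))))

∑-splits-δᴹ : ∀ α β γ → length β ≡ length α → length γ ≡ length α →
              ∑[ s ∈ splits α ] δᴹ β (proj₁ s) * δᴹ γ (proj₂ s) ≡ δᴹ (zipWith _+_ β γ) α
∑-splits-δᴹ []      []      []      _  _  = refl
∑-splits-δᴹ (a ∷ α) (b ∷ β) (g ∷ γ) lβ lγ = begin
  ∑[ s ∈ splits (a ∷ α) ] term (b ∷ β) (g ∷ γ) s
    ≡⟨ ∑-concatMap (term (b ∷ β) (g ∷ γ)) extend (upTo (suc a)) ⟩
  ∑[ i ∈ upTo (suc a) ] ∑ (term (b ∷ β) (g ∷ γ)) (extend i)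
    ≡⟨ ∑-cong split-head (upTo (suc a)) ⟩
  ∑[ i ∈ upTo (suc a) ] (δ b i * δ g (a ∸ i)) * ∑ (term β γ) (splits α)
    ≡⟨ ∑-*ʳ (∑ (term β γ) (splits α)) (λ i → δ b i * δ g (a ∸ i)) (upTo (suc a)) ⟩
  (∑[ i ∈ upTo (suc a) ] δ b i * δ g (a ∸ i)) * ∑ (term β γ) (splits α)
    ≡⟨ cong₂ _*_ (δ-convolution a b g) (∑-splits-δᴹ α β γ (suc-injective lβ) (suc-injective lγ)) ⟩
  δ (b + g) a * δᴹ (zipWith _+_ β γ) α
    ≡⟨ sym (δᴹ-∷ (b + g) (zipWith _+_ β γ) a α) ⟩
  δᴹ (zipWith _+_ (b ∷ β) (g ∷ γ)) (a ∷ α) ∎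
  where
  term : Monomial → Monomial → Monomial × Monomial → ℕ
  term β γ s = δᴹ β (proj₁ s) * δᴹ γ (proj₂ s)

  extend : ℕ → List (Monomial × Monomial)
  extend i = map (λ s → (i ∷ proj₁ s , (a ∸ i) ∷ proj₂ s)) (splits α)

  split-head : ∀ i → ∑ (term (b ∷ β) (g ∷ γ)) (extend i)
                     ≡ (δ b i * δ g (a ∸ i)) * ∑ (term β γ) (splits α)
  split-head i = begin
    ∑ (term (b ∷ β) (g ∷ γ)) (extend i)
      ≡⟨ ∑-map (term (b ∷ β) (g ∷ γ)) _ (splits α) ⟩
    ∑[ s ∈ splits α ] δᴹ (b ∷ β) (i ∷ proj₁ s) * δᴹ (g ∷ γ) ((a ∸ i) ∷ proj₂ s)
      ≡⟨ ∑-cong (λ s → trans (cong₂ _*_ (δᴹ-∷ b β i (proj₁ s)) (δᴹ-∷ g γ (a ∸ i) (proj₂ s)))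
                             (interchange *-commutativeSemigroup (δ b i) _ (δ g (a ∸ i)) _))
                (splits α) ⟩
    ∑[ s ∈ splits α ] (δ b i * δ g (a ∸ i)) * term β γ s
      ≡⟨ ∑-*ˡ (δ b i * δ g (a ∸ i)) (term β γ) (splits α) ⟩
    (δ b i * δ g (a ∸ i)) * ∑ (term β γ) (splits α) ∎

∑∑-δᴹ-zipWith : (p : A → ℕ) (q : B → ℕ) (κ : A → Monomial) (μ : B → Monomial)
                (xs : List A) (ys : List B) (α : Monomial) →
                (∀ x → length (κ x) ≡ length α) → (∀ y → length (μ y) ≡ length α) →
                ∑[ x ∈ xs ] ∑[ y ∈ ys ] p x * q y * δᴹ (zipWith _+_ (κ x) (μ y)) α
                ≡ ∑[ s ∈ splits α ] (∑[ x ∈ xs ] p x * δᴹ (κ x) (proj₁ s))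
                                    * (∑[ y ∈ ys ] q y * δᴹ (μ y) (proj₂ s))
∑∑-δᴹ-zipWith p q κ μ xs ys α κ-length μ-length = begin
  ∑[ x ∈ xs ] ∑[ y ∈ ys ] p x * q y * δᴹ (zipWith _+_ (κ x) (μ y)) α
    ≡⟨ ∑-cong (λ x → ∑-cong (expand x) ys) xs ⟩
  ∑[ x ∈ xs ] ∑[ y ∈ ys ] ∑[ s ∈ splits α ] term x y s
    ≡⟨ ∑-cong (λ x → ∑-comm (term x) ys (splits α)) xs ⟩
  ∑[ x ∈ xs ] ∑[ s ∈ splits α ] ∑[ y ∈ ys ] term x y s
    ≡⟨ ∑-comm (λ x s → ∑[ y ∈ ys ] term x y s) xs (splits α) ⟩
  ∑[ s ∈ splits α ] ∑[ x ∈ xs ] ∑[ y ∈ ys ] term x y s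
    ≡⟨ ∑-cong (λ s → sym (∑*∑ _ _ xs ys)) (splits α) ⟩
  ∑[ s ∈ splits α ] (∑[ x ∈ xs ] p x * δᴹ (κ x) (proj₁ s))
                    * (∑[ y ∈ ys ] q y * δᴹ (μ y) (proj₂ s)) ∎
  where
  term : _ → _ → Monomial × Monomial → ℕ
  term x y s = (p x * δᴹ (κ x) (proj₁ s)) * (q y * δᴹ (μ y) (proj₂ s))

  expand : ∀ x y → p x * q y * δᴹ (zipWith _+_ (κ x) (μ y)) α ≡ ∑[ s ∈ splits α ] term x y s
  expand x y = begin
    p x * q y * δᴹ (zipWith _+_ (κ x) (μ y)) α
      ≡⟨ cong (p x * q y *_) (sym (∑-splits-δᴹ α (κ x) (μ y) (κ-length x) (μ-length y))) ⟩
    p x * q y * (∑[ s ∈ splits α ] δᴹ (κ x) (proj₁ s) * δᴹ (μ y) (proj₂ s))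
      ≡⟨ sym (∑-*ˡ (p x * q y) _ (splits α)) ⟩
    ∑[ s ∈ splits α ] p x * q y * (δᴹ (κ x) (proj₁ s) * δᴹ (μ y) (proj₂ s))
      ≡⟨ ∑-cong (λ s → interchange *-commutativeSemigroup (p x) (q y) _ _) (splits α) ⟩
    ∑[ s ∈ splits α ] term x y s ∎

∑-colorings-suc : (K m : ℕ) (f : Vec ℕ (suc m) → ℕ) →
                  ∑ f (colorings K (suc m)) ≡ ∑[ x ∈ applyUpTo suc K ] ∑[ v ∈ colorings K m ] f (x ∷ v)
∑-colorings-suc K m f =
  trans (∑-concatMap f (λ x → map (x ∷_) (colorings K m)) (applyUpTo suc K))
        (∑-cong (λ x → ∑-map f (x ∷_) (colorings K m)) (applyUpTo suc K))

∑-colorings-+ : (K m : ℕ) (f : Vec ℕ (m + n) → ℕ) →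
                ∑ f (colorings K (m + n)) ≡ ∑[ u ∈ colorings K m ] ∑[ w ∈ colorings K n ] f (u ++ w)
∑-colorings-+ K zero    f = sym (+-identityʳ _)
∑-colorings-+ {n} K (suc m) f = begin
  ∑ f (colorings K (suc m + n))
    ≡⟨ ∑-colorings-suc K (m + n) f ⟩
  ∑[ x ∈ applyUpTo suc K ] ∑[ v ∈ colorings K (m + n) ] f (x ∷ v)
    ≡⟨ ∑-cong (λ x → ∑-colorings-+ K m (f ∘ (x ∷_))) (applyUpTo suc K) ⟩
  ∑[ x ∈ applyUpTo suc K ] ∑[ u ∈ colorings K m ] ∑[ w ∈ colorings K n ] f (x ∷ u ++ w)
    ≡⟨ sym (∑-colorings-suc K m (λ u → ∑[ w ∈ colorings K n ] f (u ++ w))) ⟩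
  ∑[ u ∈ colorings K (suc m) ] ∑[ w ∈ colorings K n ] f (u ++ w) ∎

take-++ : (u : Vec A m) (w : Vec A n) → take m (u ++ w) ≡ u
take-++ []      w = refl
take-++ (x ∷ u) w = cong (x ∷_) (take-++ u w)

drop-++ : (u : Vec A m) (w : Vec A n) → drop m (u ++ w) ≡ w
drop-++ []      w = refl
drop-++ (x ∷ u) w = drop-++ u w

ideal-⊗ : (c : RawCP m) (d : RawCP n) (X X′ : Subset m) (Y Y′ : Subset n) →
          ideal (c ⊗ d) (X ++ Y) (X′ ++ Y′) ≡ ideal c X X′ ∧ ideal d Y Y′
ideal-⊗ c d X X′ Y Y′ =
  cong₂ _∧_ (cong₂ (ideal c) (take-++ X Y) (take-++ X′ Y′))
            (cong₂ (ideal d) (drop-++ X Y) (drop-++ X′ Y′))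

∧-≡-true : {a b : Bool} → a ∧ b ≡ true ⇔ (a ≡ true × b ≡ true)
∧-≡-true {true}  {true}  = mk⇔ (λ _ → refl , refl) (λ _ → refl)
∧-≡-true {true}  {false} = mk⇔ (λ ()) (λ { (_ , ()) })
∧-≡-true {false}         = mk⇔ (λ ()) (λ { (() , _) })

proper-⊗ : (c : RawCP m) (d : RawCP n) (u : Vec ℕ m) (w : Vec ℕ n) →
           Proper (c ⊗ d) (u ++ w) ⇔ (Proper c u × Proper d w)
proper-⊗ c d u w = mk⇔ split join
  where
  step : ∀ k → ideal (c ⊗ d) (pre k (u ++ w)) (pre (suc k) (u ++ w)) ≡ true
               ⇔ (ideal c (pre k u) (pre (suc k) u) ≡ true × ideal d (pre k w) (pre (suc k) w) ≡ true)
  step k rewrite Vec.map-++ (_≤ᵇ k) u w | Vec.map-++ (_≤ᵇ suc k) u w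
               | ideal-⊗ c d (pre k u) (pre (suc k) u) (pre k w) (pre (suc k) w) = ∧-≡-true

  split : Proper (c ⊗ d) (u ++ w) → Proper c u × Proper d w
  split (positive , steps) =
    let positiveᵘ , positiveʷ = VecAll.++⁻ u positive
    in (positiveᵘ , λ k → proj₁ (Equivalence.to (step k) (steps k)))
     , (positiveʷ , λ k → proj₂ (Equivalence.to (step k) (steps k)))

  join : Proper c u × Proper d w → Proper (c ⊗ d) (u ++ w)
  join ((positiveᵘ , stepsᵘ) , (positiveʷ , stepsʷ)) =
    VecAll.++⁺ positiveᵘ positiveʷ , λ k → Equivalence.from (step k) (stepsᵘ k , stepsʷ k)

𝟙-proper-⊗ : (c : RawCP m) (d : RawCP n) (u : Vec ℕ m) (w : Vec ℕ n) →
             𝟙 (proper? (c ⊗ d) (u ++ w)) ≡ 𝟙 (proper? c u) * 𝟙 (proper? d w)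
𝟙-proper-⊗ c d u w =
  trans (𝟙-⇔ (proper? (c ⊗ d) (u ++ w)) (proper? c u ×-dec proper? d w) (proper-⊗ c d u w))
        (𝟙-× (proper? c u) (proper? d w))

count-++ : {P : A → Set} (P? : ∀ x → Dec (P x)) (u : Vec A m) (w : Vec A n) →
           Vec.count P? (u ++ w) ≡ Vec.count P? u + Vec.count P? w
count-++ P? []      w = refl
count-++ P? (x ∷ u) w with does (P? x)
... | true  = cong suc (count-++ P? u w)
... | false = count-++ P? u w

zipWith-+-map : (f g : A → ℕ) (xs : List A) → zipWith _+_ (map f xs) (map g xs) ≡ map (λ x → f x + g x) xs
zipWith-+-map f g []       = refl
zipWith-+-map f g (x ∷ xs) = cong (f x + g x ∷_) (zipWith-+-map f g xs)

content-++ : (K : ℕ) (u : Vec ℕ m) (w : Vec ℕ n) →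
             content K (u ++ w) ≡ zipWith _+_ (content K u) (content K w)
content-++ K u w =
  trans (map-cong (λ i → count-++ (_≟ i) u w) (applyUpTo suc K))
        (sym (zipWith-+-map (λ i → Vec.count (_≟ i) u) (λ i → Vec.count (_≟ i) w) (applyUpTo suc K)))

length-content : (K : ℕ) (u : Vec ℕ m) → length (content K u) ≡ K
length-content K u = trans (length-map _ (applyUpTo suc K)) (length-applyUpTo suc K)

chromPoly≡∑ : (c : RawCP m) (x : ℕ) → chromPoly c x ≡ ∑[ u ∈ colorings x m ] 𝟙 (proper? c u)
chromPoly≡∑ c x = length-filter (proper? c) (colorings x _)

chromQSym≡∑ : (c : RawCP m) {K : ℕ} {β : Monomial} → length β ≡ K →
              chromQSym c β ≡ ∑[ u ∈ colorings K m ] 𝟙 (proper? c u) * δᴹ (content K u) β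
chromQSym≡∑ {m} c {β = β} refl =
  trans (length-filter (λ u → ≡-dec _≟_ (content (length β) u) β) (filter (proper? c) (colorings (length β) m)))
        (∑-filter (proper? c) (λ u → δᴹ (content (length β) u) β) (colorings (length β) m))

chromPoly-⊗ : (c : RawCP m) (d : RawCP n) (x : ℕ) → chromPoly (c ⊗ d) x ≡ chromPoly c x * chromPoly d x
chromPoly-⊗ {m} {n} c d x = begin
  chromPoly (c ⊗ d) x
    ≡⟨ chromPoly≡∑ (c ⊗ d) x ⟩
  ∑[ v ∈ colorings x (m + n) ] 𝟙 (proper? (c ⊗ d) v)
    ≡⟨ ∑-colorings-+ x m _ ⟩
  ∑[ u ∈ colorings x m ] ∑[ w ∈ colorings x n ] 𝟙 (proper? (c ⊗ d) (u ++ w))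
    ≡⟨ ∑-cong (λ u → ∑-cong (𝟙-proper-⊗ c d u) (colorings x n)) (colorings x m) ⟩
  ∑[ u ∈ colorings x m ] ∑[ w ∈ colorings x n ] 𝟙 (proper? c u) * 𝟙 (proper? d w)
    ≡⟨ sym (∑*∑ _ _ (colorings x m) (colorings x n)) ⟩
  (∑[ u ∈ colorings x m ] 𝟙 (proper? c u)) * (∑[ w ∈ colorings x n ] 𝟙 (proper? d w))
    ≡⟨ sym (cong₂ _*_ (chromPoly≡∑ c x) (chromPoly≡∑ d x)) ⟩
  chromPoly c x * chromPoly d x ∎

chromQSym-⊗ : (c : RawCP m) (d : RawCP n) (α : Monomial) →
              chromQSym (c ⊗ d) α ≡ (chromQSym c ⋆ chromQSym d) α
chromQSym-⊗ {m} {n} c d α = begin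
  chromQSym (c ⊗ d) α
    ≡⟨ chromQSym≡∑ (c ⊗ d) refl ⟩
  ∑[ v ∈ colorings K (m + n) ] 𝟙 (proper? (c ⊗ d) v) * δᴹ (content K v) α
    ≡⟨ ∑-colorings-+ K m _ ⟩
  ∑[ u ∈ colorings K m ] ∑[ w ∈ colorings K n ] 𝟙 (proper? (c ⊗ d) (u ++ w)) * δᴹ (content K (u ++ w)) α
    ≡⟨ ∑-cong (λ u → ∑-cong (λ w → cong₂ _*_ (𝟙-proper-⊗ c d u w) (cong (λ κ → δᴹ κ α) (content-++ K u w)))
                            (colorings K n))
              (colorings K m) ⟩
  ∑[ u ∈ colorings K m ] ∑[ w ∈ colorings K n ]
    𝟙 (proper? c u) * 𝟙 (proper? d w) * δᴹ (zipWith _+_ (content K u) (content K w)) α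
    ≡⟨ ∑∑-δᴹ-zipWith (𝟙 ∘ proper? c) (𝟙 ∘ proper? d) (content K) (content K) (colorings K m) (colorings K n) α
                     (length-content K) (length-content K) ⟩
  ∑[ s ∈ splits α ] (∑[ u ∈ colorings K m ] 𝟙 (proper? c u) * δᴹ (content K u) (proj₁ s))
                    * (∑[ w ∈ colorings K n ] 𝟙 (proper? d w) * δᴹ (content K w) (proj₂ s))
    ≡⟨ sym (∑-cong-All (All.map (λ (lβ , lγ) → cong₂ _*_ (chromQSym≡∑ c lβ) (chromQSym≡∑ d lγ))
                                (splits-length α))) ⟩
  ∑[ s ∈ splits α ] chromQSym c (proj₁ s) * chromQSym d (proj₂ s) ∎
  where
  K = length α

mainTheorem1 : ∀ {m n} (c : RawCP m) (d : RawCP n) →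
    IsColoringProblem c → IsColoringProblem d →
    (∀ α → chromQSym (c ⊗ d) α ≡ (chromQSym c ⋆ chromQSym d) α) ×
    (∀ x → chromPoly (c ⊗ d) x ≡ chromPoly c x * chromPoly d x)
mainTheorem1 c d _ _ = chromQSym-⊗ c d , chromPoly-⊗ c d
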